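{- For every positive integer $n$, with $k = \frac{2}{3}n + 4$, the function $MAJ_n$ is computable by a circuit in the class $MAJ_k \circ MAJ_k$.
   Context: For $x=(x_1,\ldots,x_n)\in\{0,1\}^n$, $MAJ_n(x) = [x_1+\cdots+x_n \ge n/2]$, where $[P]=1$ if $P$ holds and $0$ otherwise. A threshold gate is a function $[\alpha_1 y_1 + \cdots + \alpha_m y_m \ge t]$ of Boolean inputs $y_1,\dots,y_m$ with positive integer weights $\alpha_i$ and an integer threshold $t$. The class $MAJ_k \circ MAJ_k$ consists of depth-two formulas: a collection of first-level threshold gates, each applied to some of the input variables $x_1,\dots,x_n$, and one output threshold gate applied to the outputs of the first-level gates, where every gate (first-level and output) has weights satisfying $\sum_i \alpha_i \le k$. -}

module Defs where

open import Data.Nat using (ℕ; zero; suc; _+_; _*_; _≤_; _≤ᵇ_)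
open import Data.Integer as ℤ using (ℤ; +_)
open import Data.Bool using (Bool; true; false)
open import Data.Fin using (Fin; zero; suc)
open import Data.Product using (_×_)
open import Relation.Nullary.Decidable using (does)

sumFin : (m : ℕ) → (Fin m → ℕ) → ℕ
sumFin zero    f = 0
sumFin (suc m) f = f zero + sumFin m (λ i → f (suc i))

toNat : Bool → ℕ
toNat true  = 1
toNat false = 0

-- A threshold gate on m Boolean inputs y_0..y_{m-1}:
-- [ Σ α_i y_i ≥ t ].  A weight α_i = 0 means the gate is not applied to y_i
-- (so the inputs it is applied to carry positive integer weights).
record ThresholdGate (m : ℕ) : Set where
  constructor gate
  field
    weight    : Fin m → ℕ
    threshold : ℤ

open ThresholdGate public

totalWeight : ∀ {m} → ThresholdGate m → ℕ
totalWeight {m} g = sumFin m (weight g)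

evalGate : ∀ {m} → ThresholdGate m → (Fin m → Bool) → Bool
evalGate {m} g y = does (threshold g ℤ.≤? (+ sumFin m (λ i → weight g i * toNat (y i))))

record DepthTwo (n : ℕ) : Set where
  constructor depthTwo
  field
    size       : ℕ
    firstLevel : Fin size → ThresholdGate n
    output     : ThresholdGate size

open DepthTwo public

evalDepthTwo : ∀ {n} → DepthTwo n → (Fin n → Bool) → Bool
evalDepthTwo C x = evalGate (output C) (λ j → evalGate (firstLevel C j) x)

-- every gate has total weight ≤ k, where k = 2n/3 + 4 is given as the
-- rational number kNum / kDen (so the bound reads kDen * Σα ≤ kNum).
WeightBounded : ∀ {n} → (kNum kDen : ℕ) → DepthTwo n → Set
WeightBounded kNum kDen C =
  ((j : Fin (size C)) → kDen * totalWeight (firstLevel C j) ≤ kNum) ×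
  (kDen * totalWeight (output C) ≤ kNum)

MAJ : (n : ℕ) → (Fin n → Bool) → Bool
MAJ n x = does (n Data.Nat.≤? 2 * sumFin n (λ i → toNat (x i)))

module Submission where

-- Write n = p + q with 2q ≤ p ≤ 2q + 12 and split the inputs into a left
-- block (p variables, u of them true) and a right block (q variables, c of
-- them true); put d = ⌈n/2⌉ - q.  The "staircase circuit" has
--   * q + 1 counting gates [u ≥ d + j] (j = 0 … q), each of total weight p,
--   * q unary gates [c ≥ 1 + j] (j = 0 … q - 1), each of total weight q,
--   * the output gate [number of firing gates ≥ q + 1], of total weight 2q + 1.
-- The counting gates fire min(q + 1, u + 1 - d) times and the unary gates
-- exactly c times; since c ≤ q, the output fires iff u + c ≥ q + d = ⌈n/2⌉,
-- i.e. iff MAJ_n does.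

open import Defs
open import Data.Nat using (ℕ; _+_; _*_; _≤_)
open import Data.Fin using (Fin)
open import Data.Bool using (Bool)
open import Data.Product using (Σ; _×_)
open import Relation.Binary.PropositionalEquality using (_≡_)

open import Data.Bool using (true; false)
open import Data.Nat using (zero; suc; _∸_; _⊓_; _<_; _≤?_; z≤n; s≤s; s≤s⁻¹; ⌈_/2⌉; ⌊_/2⌋)
open import Data.Nat.Properties
open import Data.Nat.DivMod using (_/_; _%_; m≡m%n+[m/n]*n; m%n<n)
open import Data.Nat.Tactic.RingSolver using (solve-∀)
open import Data.Fin using (zero; suc; toℕ; splitAt; _↑ˡ_; _↑ʳ_)
open import Data.Fin.Properties using (splitAt-↑ˡ; splitAt-↑ʳ)
open import Data.Sum using (_⊎_; [_,_]′; inj₁; inj₂)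
import Data.Integer as ℤ
open import Data.Product using (_,_)
open import Data.Empty using (⊥-elim)
open import Function.Bundles using (_⇔_; mk⇔)
open import Function.Properties.Equivalence using () renaming (trans to ⇔-trans; sym to ⇔-sym)
open import Relation.Nullary using (Dec; yes; no; does)
open import Relation.Nullary.Decidable using (does-⇔)
open import Relation.Binary.PropositionalEquality using (refl; sym; trans; cong; cong₂; subst; module ≡-Reasoning)

sumFin-cong : ∀ m {f g : Fin m → ℕ} → (∀ i → f i ≡ g i) → sumFin m f ≡ sumFin m g
sumFin-cong zero    f≗g = refl
sumFin-cong (suc m) f≗g = cong₂ _+_ (f≗g zero) (sumFin-cong m (λ i → f≗g (suc i)))

sumFin-const : ∀ m a → sumFin m (λ _ → a) ≡ m * a
sumFin-const zero    a = refl
sumFin-const (suc m) a = cong (a +_) (sumFin-const m a)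

sumFin-scale : ∀ m a (f : Fin m → ℕ) → sumFin m (λ i → a * f i) ≡ a * sumFin m f
sumFin-scale zero    a f = sym (*-zeroʳ a)
sumFin-scale (suc m) a f =
  trans (cong (a * f zero +_) (sumFin-scale m a (λ i → f (suc i))))
        (sym (*-distribˡ-+ a (f zero) _))

sumFin-split : ∀ a {b} (f : Fin (a + b) → ℕ) →
  sumFin (a + b) f ≡ sumFin a (λ i → f (i ↑ˡ b)) + sumFin b (λ j → f (a ↑ʳ j))
sumFin-split zero    f = refl
sumFin-split (suc a) f =
  trans (cong (f zero +_) (sumFin-split a (λ i → f (suc i))))
        (sym (+-assoc (f zero) _ _))

ones : (m : ℕ) → (Fin m → Bool) → ℕ
ones m x = sumFin m (λ i → toNat (x i))

ones≤ : ∀ m (x : Fin m → Bool) → ones m x ≤ m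
ones≤ zero    x = ≤-refl
ones≤ (suc m) x = +-mono-≤ (toNat≤1 (x zero)) (ones≤ m (λ i → x (suc i)))
  where
  toNat≤1 : ∀ b → toNat b ≤ 1
  toNat≤1 true  = ≤-refl
  toNat≤1 false = z≤n

blockWeight : ∀ a b → ℕ → ℕ → Fin (a + b) → ℕ
blockWeight a b α β i = [ (λ _ → α) , (λ _ → β) ]′ (splitAt a i)

blockWeight-sum : ∀ a b α β (y : Fin (a + b) → ℕ) →
  sumFin (a + b) (λ i → blockWeight a b α β i * y i)
    ≡ α * sumFin a (λ i → y (i ↑ˡ b)) + β * sumFin b (λ j → y (a ↑ʳ j))
blockWeight-sum a b α β y = begin
  sumFin (a + b) (λ i → blockWeight a b α β i * y i)
    ≡⟨ sumFin-split a _ ⟩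
  sumFin a (λ i → blockWeight a b α β (i ↑ˡ b) * y (i ↑ˡ b))
    + sumFin b (λ j → blockWeight a b α β (a ↑ʳ j) * y (a ↑ʳ j))
    ≡⟨ cong₂ _+_ (sumFin-cong a (λ i → cong (λ s → weightOn s * y (i ↑ˡ b)) (splitAt-↑ˡ a i b)))
                 (sumFin-cong b (λ j → cong (λ s → weightOn s * y (a ↑ʳ j)) (splitAt-↑ʳ a b j))) ⟩
  sumFin a (λ i → α * y (i ↑ˡ b)) + sumFin b (λ j → β * y (a ↑ʳ j))
    ≡⟨ cong₂ _+_ (sumFin-scale a α _) (sumFin-scale b β _) ⟩
  α * sumFin a (λ i → y (i ↑ˡ b)) + β * sumFin b (λ j → y (a ↑ʳ j)) ∎
  where
  open ≡-Reasoning
  weightOn : Fin a ⊎ Fin b → ℕ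
  weightOn = [ (λ _ → α) , (λ _ → β) ]′

blockWeight-total : ∀ a b α β → sumFin (a + b) (blockWeight a b α β) ≡ α * a + β * b
blockWeight-total a b α β = begin
  sumFin (a + b) (blockWeight a b α β)
    ≡⟨ sumFin-cong (a + b) (λ i → sym (*-identityʳ (blockWeight a b α β i))) ⟩
  sumFin (a + b) (λ i → blockWeight a b α β i * 1)
    ≡⟨ blockWeight-sum a b α β (λ _ → 1) ⟩
  α * sumFin a (λ _ → 1) + β * sumFin b (λ _ → 1)
    ≡⟨ cong₂ (λ s t → α * s + β * t) (trans (sumFin-const a 1) (*-identityʳ a))
                                      (trans (sumFin-const b 1) (*-identityʳ b)) ⟩
  α * a + β * b ∎
  where open ≡-Reasoning

staircase : ∀ L d u → sumFin L (λ j → toNat (does (d + toℕ j ≤? u))) ≡ L ⊓ (suc u ∸ d)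
staircase zero    d u = refl
staircase (suc L) d u = begin
  toNat (does (d + 0 ≤? u)) + sumFin L (λ j → toNat (does (d + suc (toℕ j) ≤? u)))
    ≡⟨ cong₂ _+_ (cong reached (+-identityʳ d))
                 (trans (sumFin-cong L (λ j → cong reached (+-suc d (toℕ j))))
                        (staircase L (suc d) u)) ⟩
  toNat (does (d ≤? u)) + L ⊓ (u ∸ d)
    ≡⟨ lowestStep (d ≤? u) ⟩
  suc L ⊓ (suc u ∸ d) ∎
  where
  open ≡-Reasoning
  reached : ℕ → ℕ
  reached e = toNat (does (e ≤? u))
  lowestStep : (d≤?u : Dec (d ≤ u)) → toNat (does d≤?u) + L ⊓ (u ∸ d) ≡ suc L ⊓ (suc u ∸ d)
  lowestStep (yes d≤u) = cong (suc L ⊓_) (sym (+-∸-assoc 1 d≤u))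
  lowestStep (no d≰u)
    rewrite m≤n⇒m∸n≡0 (<⇒≤ (≰⇒> d≰u)) | m≤n⇒m∸n≡0 (≰⇒> d≰u) = ⊓-zeroʳ L

capped-threshold : ∀ a b c → (a ≤ a ⊓ b + c) ⇔ (a ≤ b + c)
capped-threshold a b c = mk⇔ (λ h → ≤-trans h (+-monoˡ-≤ c (m⊓n≤n a b))) uncapped
  where
  uncapped : a ≤ b + c → a ≤ a ⊓ b + c
  uncapped h with ≤-total a b
  ... | inj₁ a≤b = subst (λ e → a ≤ e + c) (sym (m≤n⇒m⊓n≡m a≤b)) (m≤m+n a c)
  ... | inj₂ b≤a = subst (λ e → a ≤ e + c) (sym (m≥n⇒m⊓n≡n b≤a)) h

monus-threshold : ∀ m c v d → c < m → (m ≤ (v ∸ d) + c) ⇔ (m + d ≤ v + c)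
monus-threshold m c v d c<m with d ≤? v
... | yes d≤v = mk⇔ (λ h → subst (m + d ≤_) restore (+-monoˡ-≤ d h))
                    (λ h → +-cancelʳ-≤ d m _ (subst (m + d ≤_) (sym restore) h))
  where
  restore : (v ∸ d) + c + d ≡ v + c
  restore = begin
    (v ∸ d) + c + d   ≡⟨ +-assoc (v ∸ d) c d ⟩
    (v ∸ d) + (c + d) ≡⟨ cong ((v ∸ d) +_) (+-comm c d) ⟩
    (v ∸ d) + (d + c) ≡⟨ sym (+-assoc (v ∸ d) d c) ⟩
    (v ∸ d) + d + c   ≡⟨ cong (_+ c) (m∸n+n≡m d≤v) ⟩
    v + c             ∎
    where open ≡-Reasoning
... | no d≰v = mk⇔ (λ h → ⊥-elim (<⇒≱ c<m (subst (λ e → m ≤ e + c) v∸d≡0 h)))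
                   (λ h → ⊥-elim (<⇒≱ v+c<m+d h))
  where
  v<d : v < d
  v<d = ≰⇒> d≰v
  v∸d≡0 : v ∸ d ≡ 0
  v∸d≡0 = m≤n⇒m∸n≡0 (<⇒≤ v<d)
  v+c<m+d : v + c < m + d
  v+c<m+d = subst (v + c <_) (+-comm d m) (+-mono-< v<d c<m)

majority-threshold : ∀ n s → (n ≤ 2 * s) ⇔ (⌈ n /2⌉ ≤ s)
majority-threshold n s = mk⇔ halve double
  where
  2s≡s+s : 2 * s ≡ s + s
  2s≡s+s = cong (s +_) (+-identityʳ s)
  halve : n ≤ 2 * s → ⌈ n /2⌉ ≤ s
  halve h = subst (⌈ n /2⌉ ≤_) (sym (n≡⌈n+n/2⌉ s)) (⌈n/2⌉-mono (subst (n ≤_) 2s≡s+s h))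
  double : ⌈ n /2⌉ ≤ s → n ≤ 2 * s
  double h = begin
    n                     ≡⟨ sym (⌊n/2⌋+⌈n/2⌉≡n n) ⟩
    ⌊ n /2⌋ + ⌈ n /2⌉     ≤⟨ +-monoˡ-≤ ⌈ n /2⌉ (⌊n/2⌋≤⌈n/2⌉ n) ⟩
    ⌈ n /2⌉ + ⌈ n /2⌉     ≤⟨ +-mono-≤ h h ⟩
    s + s                 ≡⟨ sym 2s≡s+s ⟩
    2 * s                 ∎
    where open ≤-Reasoning

module StaircaseCircuit (p q d : ℕ) where

  left right : (Fin (p + q) → Bool) → ℕ
  left  x = ones p (λ i → x (i ↑ˡ q))
  right x = ones q (λ j → x (p ↑ʳ j))

  countingGate : Fin (suc q) → ThresholdGate (p + q)
  countingGate j = gate (blockWeight p q 1 0) (ℤ.+ (d + toℕ j))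

  unaryGate : Fin q → ThresholdGate (p + q)
  unaryGate j = gate (blockWeight p q 0 1) (ℤ.+ (1 + toℕ j))

  circuit : DepthTwo (p + q)
  circuit = depthTwo (suc q + q)
    (λ j → [ countingGate , unaryGate ]′ (splitAt (suc q) j))
    (gate (λ _ → 1) (ℤ.+ suc q))

  countingGate-eval : ∀ x j → evalGate (countingGate j) x ≡ does (d + toℕ j ≤? left x)
  countingGate-eval x j =
    cong (λ s → does (d + toℕ j ≤? s))
      (trans (blockWeight-sum p q 1 0 (λ i → toNat (x i)))
             (trans (+-identityʳ (1 * left x)) (*-identityˡ (left x))))

  unaryGate-eval : ∀ x j → evalGate (unaryGate j) x ≡ does (1 + toℕ j ≤? right x)
  unaryGate-eval x j =
    cong (λ s → does (1 + toℕ j ≤? s))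
      (trans (blockWeight-sum p q 0 1 (λ i → toNat (x i))) (*-identityˡ (right x)))

  firing : ∀ x →
    sumFin (suc q + q) (λ j → 1 * toNat (evalGate (firstLevel circuit j) x))
      ≡ suc q ⊓ (suc (left x) ∸ d) + right x
  firing x = begin
    sumFin (suc q + q) (λ j → 1 * toNat (evalGate (firstLevel circuit j) x))
      ≡⟨ sumFin-split (suc q) (λ j → 1 * toNat (evalGate (firstLevel circuit j) x)) ⟩
    sumFin (suc q) (λ j → 1 * toNat (evalGate (firstLevel circuit (j ↑ˡ q)) x))
      + sumFin q (λ j → 1 * toNat (evalGate (firstLevel circuit (suc q ↑ʳ j)) x))
      ≡⟨ cong₂ _+_ (sumFin-cong (suc q) (λ j → trans (*-identityˡ _) (cong fires (splitAt-↑ˡ (suc q) j q))))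
                   (sumFin-cong q (λ j → trans (*-identityˡ _) (cong fires (splitAt-↑ʳ (suc q) q j)))) ⟩
    sumFin (suc q) (λ j → toNat (evalGate (countingGate j) x))
      + sumFin q (λ j → toNat (evalGate (unaryGate j) x))
      ≡⟨ cong₂ _+_ (trans (sumFin-cong (suc q) (λ j → cong toNat (countingGate-eval x j)))
                          (staircase (suc q) d (left x)))
                   (trans (sumFin-cong q (λ j → cong toNat (unaryGate-eval x j)))
                          (trans (staircase q 1 (right x)) (m≥n⇒m⊓n≡n (ones≤ q _)))) ⟩
    suc q ⊓ (suc (left x) ∸ d) + right x ∎
    where
    open ≡-Reasoning
    fires : Fin (suc q) ⊎ Fin q → ℕ
    fires s = toNat (evalGate ([ countingGate , unaryGate ]′ s) x)

  circuit-eval : ∀ x → evalDepthTwo circuit x ≡ does (q + d ≤? ones (p + q) x)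
  circuit-eval x = begin
    evalDepthTwo circuit x
      ≡⟨ cong (λ s → does (suc q ≤? s)) (firing x) ⟩
    does (suc q ≤? suc q ⊓ (suc (left x) ∸ d) + right x)
      ≡⟨ does-⇔ firingThreshold (suc q ≤? _) (q + d ≤? _) ⟩
    does (q + d ≤? left x + right x)
      ≡⟨ cong (λ s → does (q + d ≤? s)) (sym (sumFin-split p _)) ⟩
    does (q + d ≤? ones (p + q) x) ∎
    where
    open ≡-Reasoning
    firingThreshold : (suc q ≤ suc q ⊓ (suc (left x) ∸ d) + right x) ⇔ (q + d ≤ left x + right x)
    firingThreshold =
      ⇔-trans (capped-threshold (suc q) _ (right x))
              (⇔-trans (monus-threshold (suc q) (right x) (suc (left x)) d (s≤s (ones≤ q _)))
                       (mk⇔ s≤s⁻¹ s≤s))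

  circuit-bounded : 2 * q ≤ p → p ≤ 2 * q + 12 → WeightBounded (2 * (p + q) + 12) 3 circuit
  circuit-bounded 2q≤p p≤2q+12 = firstLevelBounded , outputBounded
    where
    open ≤-Reasoning
    q≤p : q ≤ p
    q≤p = ≤-trans (m≤m+n q (q + 0)) 2q≤p
    bound : 2 * (p + q) + 12 ≡ 2 * p + (2 * q + 12)
    bound = trans (cong (_+ 12) (*-distribˡ-+ 2 p q)) (+-assoc (2 * p) (2 * q) 12)
    atMost-p : ∀ {w} → w ≤ p → 3 * w ≤ 2 * (p + q) + 12
    atMost-p {w} w≤p = begin
      3 * w              ≤⟨ *-monoʳ-≤ 3 w≤p ⟩
      p + 2 * p          ≡⟨ +-comm p (2 * p) ⟩
      2 * p + p          ≤⟨ +-monoʳ-≤ (2 * p) p≤2q+12 ⟩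
      2 * p + (2 * q + 12) ≡⟨ sym bound ⟩
      2 * (p + q) + 12   ∎
    firstLevelBounded : ∀ j → 3 * totalWeight (firstLevel circuit j) ≤ 2 * (p + q) + 12
    firstLevelBounded j with splitAt (suc q) j
    ... | inj₁ _ = atMost-p (≤-reflexive (trans (blockWeight-total p q 1 0)
                                                 (trans (+-identityʳ (1 * p)) (*-identityˡ p))))
    ... | inj₂ _ = atMost-p (subst (_≤ p) (sym (trans (blockWeight-total p q 0 1) (*-identityˡ q))) q≤p)
    outputShape : ∀ q → 3 * ((suc q + q) * 1) ≡ 2 * (2 * q) + (2 * q + 3)
    outputShape = solve-∀
    outputBounded : 3 * totalWeight (output circuit) ≤ 2 * (p + q) + 12
    outputBounded = begin
      3 * sumFin (suc q + q) (λ _ → 1) ≡⟨ cong (3 *_) (sumFin-const (suc q + q) 1) ⟩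
      3 * ((suc q + q) * 1)            ≡⟨ outputShape q ⟩
      2 * (2 * q) + (2 * q + 3)        ≤⟨ +-mono-≤ (*-monoʳ-≤ 2 2q≤p) (+-monoʳ-≤ (2 * q) (m≤m+n 3 9)) ⟩
      2 * p + (2 * q + 12)             ≡⟨ sym bound ⟩
      2 * (p + q) + 12                 ∎

MajorityCircuit : ℕ → Set
MajorityCircuit n = Σ (DepthTwo n) λ C →
  WeightBounded (2 * n + 12) 3 C × ((x : Fin n → Bool) → evalDepthTwo C x ≡ MAJ n x)

majorityCircuit : ∀ p q → 2 * q ≤ p → p ≤ 2 * q + 12 → MajorityCircuit (p + q)
majorityCircuit p q 2q≤p p≤2q+12 =
  circuit , circuit-bounded 2q≤p p≤2q+12 ,
  λ x → trans (circuit-eval x) (does-⇔ (reachesHalf (ones (p + q) x)) (_ ≤? _) (p + q ≤? _))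
  where
  open StaircaseCircuit p q (⌈ p + q /2⌉ ∸ q)
  q≤half : q ≤ ⌈ p + q /2⌉
  q≤half = subst (_≤ ⌈ p + q /2⌉) (sym (n≡⌈n+n/2⌉ q))
                 (⌈n/2⌉-mono (+-monoˡ-≤ q (≤-trans (m≤m+n q (q + 0)) 2q≤p)))
  reachesHalf : ∀ s → (q + (⌈ p + q /2⌉ ∸ q) ≤ s) ⇔ (p + q ≤ 2 * s)
  reachesHalf s = subst (λ h → (h ≤ s) ⇔ (p + q ≤ 2 * s)) (sym (m+[n∸m]≡n q≤half))
                      (⇔-sym (majority-threshold (p + q) s))

mainTheorem1 : (n : ℕ) → 1 ≤ n →
    Σ (DepthTwo n) λ C →
      WeightBounded (2 * n + 12) 3 C ×
      ((x : Fin n → Bool) → evalDepthTwo C x ≡ MAJ n x)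
mainTheorem1 n _ =
  subst MajorityCircuit (sym n≡p+q)
    (majorityCircuit (2 * q + r) q (m≤m+n (2 * q) r) (+-monoʳ-≤ (2 * q) r≤12))
  where
  q r : ℕ
  q = n / 3
  r = n % 3
  r≤12 : r ≤ 12
  r≤12 = ≤-trans (<⇒≤ (m%n<n n 3)) (m≤m+n 3 9)
  regroup : ∀ r q → r + q * 3 ≡ (2 * q + r) + q
  regroup = solve-∀
  n≡p+q : n ≡ (2 * q + r) + q
  n≡p+q = trans (m≡m%n+[m/n]*n n 3) (regroup r q)
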